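{- Let $n\geq 2k$ and $k\geq 1$ be integers. A set $\mathcal{S}$ of vertices of the Johnson graph $J(n,k)$ is a resolving set for $J(n,k)$ if and only if for any two disjoint non-empty sets $U,W\subset[n]$ with $|U|=|W|\leq k$ there exists $X\in\mathcal{S}$ with $|X\cap U|\neq|X\cap W|$.
   Context: $[n]=\{1,\dots,n\}$. The Johnson graph $J(n,k)$ has as vertices the $k$-subsets of $[n]$, two being adjacent when their intersection has size $k-1$; its graph distance satisfies $d(U,W)=k-|U\cap W|$. A set $\mathcal{S}$ of vertices is a resolving set if for every pair of distinct vertices $U,W$ there is $X\in\mathcal{S}$ with $d(U,X)\neq d(W,X)$. -}

module Defs where

open import Level using (0ℓ)
open import Data.Nat using (ℕ; _∸_; _≤_)
open import Data.Product using (Σ; _×_; _,_)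
open import Data.Fin.Subset using (Subset; _∩_; ∣_∣; Nonempty; ⊥)
open import Relation.Binary.PropositionalEquality using (_≡_; _≢_)

IsVertex : ∀ {n} → ℕ → Subset n → Set
IsVertex k U = ∣ U ∣ ≡ k

-- Distance in J(n,k), as given in the paper: d(U,W) = k - |U ∩ W|.
jdist : ∀ {n} → ℕ → Subset n → Subset n → ℕ
jdist k U W = k ∸ ∣ U ∩ W ∣

VertexSet : ℕ → ℕ → Set₁
VertexSet n k = Σ (Subset n → Set) λ S → ∀ X → S X → IsVertex k X

IsResolving : ∀ {n k} → VertexSet n k → Set
IsResolving {n} {k} (S , _) =
  ∀ (U W : Subset n) → IsVertex k U → IsVertex k W → U ≢ W →
  Σ (Subset n) λ X → S X × (jdist k U X ≢ jdist k W X)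

DisjointCondition : ∀ {n k} → VertexSet n k → Set
DisjointCondition {n} {k} (S , _) =
  ∀ (U W : Subset n) → U ∩ W ≡ ⊥ → Nonempty U → Nonempty W →
  ∣ U ∣ ≡ ∣ W ∣ → ∣ U ∣ ≤ k →
  Σ (Subset n) λ X → S X × (∣ X ∩ U ∣ ≢ ∣ X ∩ W ∣)

-- On vertices U, W (k-subsets of [n]) the distance d(U,X) = k - |U ∩ X| is
-- determined by the overlap |X ∩ U|, so X resolves U and W exactly when
-- |X ∩ U| ≠ |X ∩ W|.  Both directions then reduce to counting overlaps of
-- disjoint pieces, where |X ∩ (A ∪ B)| = |X ∩ A| + |X ∩ B| for disjoint A, B.
--
-- (⇒) Given disjoint non-empty U, W with |U| = |W| = m ≤ k, pad both with a
--     set Z of k - m points outside U ∪ W (it exists since 2m + (k - m) ≤ 2k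
--     ≤ n).  U ∪ Z and W ∪ Z are distinct vertices, and a vertex X resolving
--     them satisfies |X ∩ U| ≠ |X ∩ W| because the contributions of Z cancel.
-- (⇐) Given distinct vertices U, W, the differences U ∖ W and W ∖ U are
--     disjoint, of equal size k - |U ∩ W| ≤ k, and non-empty.  A vertex X
--     separating their overlaps separates those of U and W, since both share
--     the common part U ∩ W.
module Submission where

open import Defs
open import Data.Nat using (ℕ; _≤_; _*_)
open import Function.Bundles using (_⇔_; mk⇔; Equivalence)
open import Data.Nat using (zero; suc; _+_; _∸_; s≤s)
open import Data.Nat.Properties
  using (+-suc; +-assoc; +-identityʳ; +-cancelˡ-≡; +-monoˡ-≤; ≤-trans;
         m+[n∸m]≡n; m+n∸m≡n; ∸-monoˡ-≤; ∸-cancelˡ-≡; module ≤-Reasoning)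
open import Data.Bool using (true; false)
open import Data.Vec using ([]; _∷_; tail)
open import Data.Fin.Subset
open import Data.Fin.Subset.Properties
  using (∩-comm; ∩-idem; ∩-identityˡ; ∩-identityʳ; ∩-inverseʳ; ∩-distribˡ-∪; ∩-distribʳ-∪;
         ∪-identityˡ; ∪-identityʳ; ∪-inverseʳ;
         ⊆-min; s⊆s; p⊆p∪q; q⊆p∪q; p∩q⊆p; p∩q⊆q; x∈p∩q⁺; x∈p∩q⁻; ∉⊥;
         ∣⊥∣≡0; ∣∁p∣≡n∸∣p∣; ∣⁅x⁆∣≡1; x∈⁅y⁆⇒x≡y; p⊆q⇒∣p∣≤∣q∣; Empty-unique; nonempty?)
open import Data.Product using (Σ; _×_; _,_; proj₁; proj₂)
open import Relation.Binary.PropositionalEquality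
open import Relation.Nullary using (yes; no; contradiction)

private
  variable
    m : ℕ

disjoint-mono : {A A′ B B′ : Subset m} → A′ ⊆ A → B′ ⊆ B → A ∩ B ≡ ⊥ → A′ ∩ B′ ≡ ⊥
disjoint-mono {A′ = A′} {B′ = B′} A′⊆A B′⊆B A∩B≡⊥ = Empty-unique λ (x , x∈A′∩B′) →
  let (x∈A′ , x∈B′) = x∈p∩q⁻ A′ B′ x∈A′∩B′
  in ∉⊥ (subst (x ∈_) A∩B≡⊥ (x∈p∩q⁺ (A′⊆A x∈A′ , B′⊆B x∈B′)))

partition : (A B : Subset m) → A ≡ (A ∩ B) ∪ (A ∩ ∁ B)
partition A B = begin
  A                         ≡⟨ sym (∩-identityʳ A) ⟩
  A ∩ ⊤                     ≡⟨ cong (A ∩_) (sym (∪-inverseʳ B)) ⟩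
  A ∩ (B ∪ ∁ B)             ≡⟨ ∩-distribˡ-∪ A B (∁ B) ⟩
  (A ∩ B) ∪ (A ∩ ∁ B)       ∎
  where open ≡-Reasoning

partition-disjoint : (A B : Subset m) → (A ∩ B) ∩ (A ∩ ∁ B) ≡ ⊥
partition-disjoint A B = disjoint-mono (p∩q⊆q A B) (p∩q⊆q A (∁ B)) (∩-inverseʳ B)

disjoint⇒∩∁ : (A B : Subset m) → A ∩ B ≡ ⊥ → A ∩ ∁ B ≡ A
disjoint⇒∩∁ A B A∩B≡⊥ = begin
  A ∩ ∁ B                   ≡⟨ sym (∪-identityˡ (A ∩ ∁ B)) ⟩
  ⊥ ∪ (A ∩ ∁ B)             ≡⟨ cong (_∪ (A ∩ ∁ B)) (sym A∩B≡⊥) ⟩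
  (A ∩ B) ∪ (A ∩ ∁ B)       ≡⟨ sym (partition A B) ⟩
  A                         ∎
  where open ≡-Reasoning

∪-cancelʳ-disjoint : (A B Z : Subset m) → A ∩ Z ≡ ⊥ → B ∩ Z ≡ ⊥ → A ∪ Z ≡ B ∪ Z → A ≡ B
∪-cancelʳ-disjoint A B Z A∩Z≡⊥ B∩Z≡⊥ eq = begin
  A                         ≡⟨ sym (disjoint⇒∩∁ A Z A∩Z≡⊥) ⟩
  A ∩ ∁ Z                   ≡⟨ remove-Z A ⟩
  (A ∪ Z) ∩ ∁ Z             ≡⟨ cong (_∩ ∁ Z) eq ⟩
  (B ∪ Z) ∩ ∁ Z             ≡⟨ sym (remove-Z B) ⟩
  B ∩ ∁ Z                   ≡⟨ disjoint⇒∩∁ B Z B∩Z≡⊥ ⟩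
  B                         ∎
  where
  open ≡-Reasoning
  remove-Z : (C : Subset _) → C ∩ ∁ Z ≡ (C ∪ Z) ∩ ∁ Z
  remove-Z C = begin
    C ∩ ∁ Z                 ≡⟨ sym (∪-identityʳ (C ∩ ∁ Z)) ⟩
    (C ∩ ∁ Z) ∪ ⊥           ≡⟨ cong ((C ∩ ∁ Z) ∪_) (sym (∩-inverseʳ Z)) ⟩
    (C ∩ ∁ Z) ∪ (Z ∩ ∁ Z)   ≡⟨ sym (∩-distribʳ-∪ (∁ Z) C Z) ⟩
    (C ∪ Z) ∩ ∁ Z           ∎

differences-empty⇒≡ : (A B : Subset m) → A ∩ ∁ B ≡ ⊥ → B ∩ ∁ A ≡ ⊥ → A ≡ B
differences-empty⇒≡ A B A∖B≡⊥ B∖A≡⊥ = begin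
  A                         ≡⟨ partition A B ⟩
  (A ∩ B) ∪ (A ∩ ∁ B)       ≡⟨ cong ((A ∩ B) ∪_) A∖B≡⊥ ⟩
  (A ∩ B) ∪ ⊥               ≡⟨ ∪-identityʳ (A ∩ B) ⟩
  A ∩ B                     ≡⟨ ∩-comm A B ⟩
  B ∩ A                     ≡⟨ sym (∪-identityʳ (B ∩ A)) ⟩
  (B ∩ A) ∪ ⊥               ≡⟨ cong ((B ∩ A) ∪_) (sym B∖A≡⊥) ⟩
  (B ∩ A) ∪ (B ∩ ∁ A)       ≡⟨ sym (partition B A) ⟩
  B                         ∎
  where open ≡-Reasoning

∣∪∣-disjoint : (A B : Subset m) → A ∩ B ≡ ⊥ → ∣ A ∪ B ∣ ≡ ∣ A ∣ + ∣ B ∣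
∣∪∣-disjoint []          []          _  = refl
∣∪∣-disjoint (true  ∷ A) (true  ∷ B) ()
∣∪∣-disjoint (true  ∷ A) (false ∷ B) eq = cong suc (∣∪∣-disjoint A B (cong tail eq))
∣∪∣-disjoint (false ∷ A) (true  ∷ B) eq =
  trans (cong suc (∣∪∣-disjoint A B (cong tail eq))) (sym (+-suc ∣ A ∣ ∣ B ∣))
∣∪∣-disjoint (false ∷ A) (false ∷ B) eq = ∣∪∣-disjoint A B (cong tail eq)

overlap-∪ : (X A B : Subset m) → A ∩ B ≡ ⊥ → ∣ X ∩ (A ∪ B) ∣ ≡ ∣ X ∩ A ∣ + ∣ X ∩ B ∣
overlap-∪ X A B A∩B≡⊥ = begin
  ∣ X ∩ (A ∪ B) ∣           ≡⟨ cong ∣_∣ (∩-distribˡ-∪ X A B) ⟩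
  ∣ (X ∩ A) ∪ (X ∩ B) ∣     ≡⟨ ∣∪∣-disjoint (X ∩ A) (X ∩ B) pieces-disjoint ⟩
  ∣ X ∩ A ∣ + ∣ X ∩ B ∣     ∎
  where
  open ≡-Reasoning
  pieces-disjoint : (X ∩ A) ∩ (X ∩ B) ≡ ⊥
  pieces-disjoint = disjoint-mono (p∩q⊆q X A) (p∩q⊆q X B) A∩B≡⊥

padding-keeps-equal-overlap : (X U W Z : Subset m) → U ∩ Z ≡ ⊥ → W ∩ Z ≡ ⊥ →
  ∣ X ∩ U ∣ ≡ ∣ X ∩ W ∣ → ∣ X ∩ (U ∪ Z) ∣ ≡ ∣ X ∩ (W ∪ Z) ∣
padding-keeps-equal-overlap X U W Z U∩Z≡⊥ W∩Z≡⊥ eq = begin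
  ∣ X ∩ (U ∪ Z) ∣           ≡⟨ overlap-∪ X U Z U∩Z≡⊥ ⟩
  ∣ X ∩ U ∣ + ∣ X ∩ Z ∣     ≡⟨ cong (_+ ∣ X ∩ Z ∣) eq ⟩
  ∣ X ∩ W ∣ + ∣ X ∩ Z ∣     ≡⟨ sym (overlap-∪ X W Z W∩Z≡⊥) ⟩
  ∣ X ∩ (W ∪ Z) ∣           ∎
  where open ≡-Reasoning

overlap-partition : (X A B : Subset m) → ∣ X ∩ A ∣ ≡ ∣ X ∩ (A ∩ B) ∣ + ∣ X ∩ (A ∩ ∁ B) ∣
overlap-partition X A B = trans (cong ∣_∣ (cong (X ∩_) (partition A B)))
                                (overlap-∪ X (A ∩ B) (A ∩ ∁ B) (partition-disjoint A B))

-- Sets with equal overlap with X also have equal overlap on their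
-- differences, since their common part contributes equally to both.
overlap-differences : (X U W : Subset m) → ∣ X ∩ U ∣ ≡ ∣ X ∩ W ∣ →
  ∣ X ∩ (U ∩ ∁ W) ∣ ≡ ∣ X ∩ (W ∩ ∁ U) ∣
overlap-differences X U W eq = +-cancelˡ-≡ ∣ X ∩ (U ∩ W) ∣ _ _ (begin
  ∣ X ∩ (U ∩ W) ∣ + ∣ X ∩ (U ∩ ∁ W) ∣   ≡⟨ sym (overlap-partition X U W) ⟩
  ∣ X ∩ U ∣                             ≡⟨ eq ⟩
  ∣ X ∩ W ∣                             ≡⟨ overlap-partition X W U ⟩
  ∣ X ∩ (W ∩ U) ∣ + ∣ X ∩ (W ∩ ∁ U) ∣   ≡⟨ cong (λ C → ∣ X ∩ C ∣ + ∣ X ∩ (W ∩ ∁ U) ∣) (∩-comm W U) ⟩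
  ∣ X ∩ (U ∩ W) ∣ + ∣ X ∩ (W ∩ ∁ U) ∣   ∎)
  where open ≡-Reasoning

-- The case X = ⊤: sets of equal size have differences of equal size.
equal-differences : (U W : Subset m) → ∣ U ∣ ≡ ∣ W ∣ → ∣ U ∩ ∁ W ∣ ≡ ∣ W ∩ ∁ U ∣
equal-differences U W eq = subst₂ _≡_ (whole (U ∩ ∁ W)) (whole (W ∩ ∁ U))
  (overlap-differences ⊤ U W (subst₂ _≡_ (sym (whole U)) (sym (whole W)) eq))
  where
  whole : (A : Subset _) → ∣ ⊤ ∩ A ∣ ≡ ∣ A ∣
  whole A = cong ∣_∣ (∩-identityˡ A)

∣p∣≡0⇒p≡⊥ : (p : Subset m) → ∣ p ∣ ≡ 0 → p ≡ ⊥
∣p∣≡0⇒p≡⊥ p ∣p∣≡0 = Empty-unique λ (x , x∈p) →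
  let ⁅x⁆⊆p : ⁅ x ⁆ ⊆ p
      ⁅x⁆⊆p y∈⁅x⁆ = subst (_∈ p) (sym (x∈⁅y⁆⇒x≡y x y∈⁅x⁆)) x∈p
  in contradiction (subst₂ _≤_ (∣⁅x⁆∣≡1 x) ∣p∣≡0 (p⊆q⇒∣p∣≤∣q∣ ⁅x⁆⊆p)) λ ()

subset-of-size : (A : Subset m) (r : ℕ) → r ≤ ∣ A ∣ → Σ (Subset m) λ Z → Z ⊆ A × ∣ Z ∣ ≡ r
subset-of-size {m} A     zero    _        = ⊥ , ⊆-min A , ∣⊥∣≡0 m
subset-of-size (true  ∷ A) (suc r) (s≤s r≤∣A∣) =
  let (Z , Z⊆A , ∣Z∣≡r) = subset-of-size A r r≤∣A∣ in true ∷ Z , s⊆s Z⊆A , cong suc ∣Z∣≡r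
subset-of-size (false ∷ A) (suc r) r<∣A∣ =
  let (Z , Z⊆A , ∣Z∣≡r) = subset-of-size A (suc r) r<∣A∣ in false ∷ Z , s⊆s Z⊆A , ∣Z∣≡r

-- If |V| + r ≤ m, some r-subset of Fin m avoids V (take it inside ∁ V).
avoiding-subset : (V : Subset m) (r : ℕ) → ∣ V ∣ + r ≤ m →
  Σ (Subset m) λ Z → V ∩ Z ≡ ⊥ × ∣ Z ∣ ≡ r
avoiding-subset {m} V r bound =
  let (Z , Z⊆∁V , ∣Z∣≡r) = subset-of-size (∁ V) r r≤∣∁V∣
  in Z , disjoint-mono (λ x∈V → x∈V) Z⊆∁V (∩-inverseʳ V) , ∣Z∣≡r
  where
  r≤∣∁V∣ : r ≤ ∣ ∁ V ∣
  r≤∣∁V∣ = subst₂ _≤_ (m+n∸m≡n ∣ V ∣ r) (sym (∣∁p∣≡n∸∣p∣ V)) (∸-monoˡ-≤ ∣ V ∣ bound)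

difference-nonempty : {m : ℕ} (U W : Subset m) → U ≢ W → ∣ U ∩ ∁ W ∣ ≡ ∣ W ∩ ∁ U ∣ →
  Nonempty (U ∩ ∁ W)
difference-nonempty {m} U W U≢W sizes with nonempty? (U ∩ ∁ W)
... | yes nonempty = nonempty
... | no  empty    = contradiction (differences-empty⇒≡ U W U∖W≡⊥ W∖U≡⊥) U≢W
  where
  U∖W≡⊥ : U ∩ ∁ W ≡ ⊥
  U∖W≡⊥ = Empty-unique empty
  W∖U≡⊥ : W ∩ ∁ U ≡ ⊥
  W∖U≡⊥ = ∣p∣≡0⇒p≡⊥ (W ∩ ∁ U) (trans (sym sizes) (trans (cong ∣_∣ U∖W≡⊥) (∣⊥∣≡0 m)))

jdist≡⇔overlap≡ : {k : ℕ} (U W X : Subset m) → IsVertex k U → IsVertex k W →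
  (jdist k U X ≡ jdist k W X) ⇔ (∣ X ∩ U ∣ ≡ ∣ X ∩ W ∣)
jdist≡⇔overlap≡ {k = k} U W X ∣U∣≡k ∣W∣≡k = mk⇔ to from
  where
  overlap≤k : (A : Subset _) → ∣ A ∣ ≡ k → ∣ X ∩ A ∣ ≤ k
  overlap≤k A ∣A∣≡k = subst (∣ X ∩ A ∣ ≤_) ∣A∣≡k (p⊆q⇒∣p∣≤∣q∣ (p∩q⊆q X A))
  swap : (A : Subset _) → ∣ A ∩ X ∣ ≡ ∣ X ∩ A ∣
  swap A = cong ∣_∣ (∩-comm A X)
  to : jdist k U X ≡ jdist k W X → ∣ X ∩ U ∣ ≡ ∣ X ∩ W ∣
  to eq = ∸-cancelˡ-≡ (overlap≤k U ∣U∣≡k) (overlap≤k W ∣W∣≡k)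
            (subst₂ (λ a b → k ∸ a ≡ k ∸ b) (swap U) (swap W) eq)
  from : ∣ X ∩ U ∣ ≡ ∣ X ∩ W ∣ → jdist k U X ≡ jdist k W X
  from eq = cong (k ∸_) (trans (swap U) (trans eq (sym (swap W))))

padded-size : (A Z : Subset m) {k : ℕ} → A ∩ Z ≡ ⊥ → ∣ A ∣ ≤ k → ∣ Z ∣ ≡ k ∸ ∣ A ∣ →
  IsVertex k (A ∪ Z)
padded-size A Z A∩Z≡⊥ ∣A∣≤k ∣Z∣≡k∸∣A∣ =
  trans (∣∪∣-disjoint A Z A∩Z≡⊥) (trans (cong (∣ A ∣ +_) ∣Z∣≡k∸∣A∣) (m+[n∸m]≡n ∣A∣≤k))

padding-room : (a k : ℕ) → a ≤ k → (a + a) + (k ∸ a) ≤ 2 * k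
padding-room a k a≤k = begin
  (a + a) + (k ∸ a)         ≡⟨ +-assoc a a (k ∸ a) ⟩
  a + (a + (k ∸ a))         ≡⟨ cong (a +_) (m+[n∸m]≡n a≤k) ⟩
  a + k                     ≤⟨ +-monoˡ-≤ k a≤k ⟩
  k + k                     ≡⟨ cong (k +_) (sym (+-identityʳ k)) ⟩
  2 * k                     ∎
  where open ≤-Reasoning

-- (⇒): pad two disjoint equal-size sets to vertices with a common set Z.
resolving⇒disjoint-condition : (n k : ℕ) → 2 * k ≤ n → (𝒮 : VertexSet n k) →
  IsResolving 𝒮 → DisjointCondition 𝒮
resolving⇒disjoint-condition n k 2k≤n 𝒮 resolves U W U∩W≡⊥ (x , x∈U) _ ∣U∣≡∣W∣ ∣U∣≤k =
  X , X∈S , λ eq → separates (Equivalence.from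
    (jdist≡⇔overlap≡ (U ∪ Z) (W ∪ Z) X U∪Z-vertex W∪Z-vertex)
    (padding-keeps-equal-overlap X U W Z U∩Z≡⊥ W∩Z≡⊥ eq))
  where
  room : ∣ U ∪ W ∣ + (k ∸ ∣ U ∣) ≤ n
  room = ≤-trans (subst (λ s → s + (k ∸ ∣ U ∣) ≤ 2 * k) ∣U∪W∣≡ (padding-room ∣ U ∣ k ∣U∣≤k)) 2k≤n
    where
    ∣U∪W∣≡ : ∣ U ∣ + ∣ U ∣ ≡ ∣ U ∪ W ∣
    ∣U∪W∣≡ = sym (trans (∣∪∣-disjoint U W U∩W≡⊥) (cong (∣ U ∣ +_) (sym ∣U∣≡∣W∣)))
  padding : Σ (Subset n) λ Z → (U ∪ W) ∩ Z ≡ ⊥ × ∣ Z ∣ ≡ k ∸ ∣ U ∣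
  padding = avoiding-subset (U ∪ W) (k ∸ ∣ U ∣) room
  Z : Subset n
  Z = proj₁ padding
  U∩Z≡⊥ : U ∩ Z ≡ ⊥
  U∩Z≡⊥ = disjoint-mono (p⊆p∪q W) (λ z∈Z → z∈Z) (proj₁ (proj₂ padding))
  W∩Z≡⊥ : W ∩ Z ≡ ⊥
  W∩Z≡⊥ = disjoint-mono (q⊆p∪q U W) (λ z∈Z → z∈Z) (proj₁ (proj₂ padding))
  U∪Z-vertex : IsVertex k (U ∪ Z)
  U∪Z-vertex = padded-size U Z U∩Z≡⊥ ∣U∣≤k (proj₂ (proj₂ padding))
  W∪Z-vertex : IsVertex k (W ∪ Z)
  W∪Z-vertex = padded-size W Z W∩Z≡⊥ (subst (_≤ k) ∣U∣≡∣W∣ ∣U∣≤k)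
                 (subst (λ s → ∣ Z ∣ ≡ k ∸ s) ∣U∣≡∣W∣ (proj₂ (proj₂ padding)))
  -- U ≠ W since U is non-empty and disjoint from W.
  U≢W : U ≢ W
  U≢W U≡W = ∉⊥ (subst (x ∈_) (trans (sym (∩-idem U)) (trans (cong (U ∩_) U≡W) U∩W≡⊥)) x∈U)
  resolver : Σ (Subset n) λ X → proj₁ 𝒮 X × jdist k (U ∪ Z) X ≢ jdist k (W ∪ Z) X
  resolver = resolves (U ∪ Z) (W ∪ Z) U∪Z-vertex W∪Z-vertex
               (λ eq → U≢W (∪-cancelʳ-disjoint U W Z U∩Z≡⊥ W∩Z≡⊥ eq))
  X : Subset n
  X = proj₁ resolver
  X∈S : proj₁ 𝒮 X
  X∈S = proj₁ (proj₂ resolver)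
  separates : jdist k (U ∪ Z) X ≢ jdist k (W ∪ Z) X
  separates = proj₂ (proj₂ resolver)

-- (⇐): apply the condition to the differences U ∖ W and W ∖ U.
disjoint-condition⇒resolving : (n k : ℕ) (𝒮 : VertexSet n k) →
  DisjointCondition 𝒮 → IsResolving 𝒮
disjoint-condition⇒resolving n k 𝒮 condition U W ∣U∣≡k ∣W∣≡k U≢W =
  X , X∈S , λ eq → separates
    (overlap-differences X U W (Equivalence.to (jdist≡⇔overlap≡ U W X ∣U∣≡k ∣W∣≡k) eq))
  where
  sizes : ∣ U ∩ ∁ W ∣ ≡ ∣ W ∩ ∁ U ∣
  sizes = equal-differences U W (trans ∣U∣≡k (sym ∣W∣≡k))
  separator : Σ (Subset n) λ X → proj₁ 𝒮 X × ∣ X ∩ (U ∩ ∁ W) ∣ ≢ ∣ X ∩ (W ∩ ∁ U) ∣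
  separator = condition (U ∩ ∁ W) (W ∩ ∁ U)
    (disjoint-mono (p∩q⊆p U (∁ W)) (p∩q⊆q W (∁ U)) (∩-inverseʳ U))
    (difference-nonempty U W U≢W sizes)
    (difference-nonempty W U (λ eq → U≢W (sym eq)) (sym sizes))
    sizes
    (subst (∣ U ∩ ∁ W ∣ ≤_) ∣U∣≡k (p⊆q⇒∣p∣≤∣q∣ (p∩q⊆p U (∁ W))))
  X : Subset n
  X = proj₁ separator
  X∈S : proj₁ 𝒮 X
  X∈S = proj₁ (proj₂ separator)
  separates : ∣ X ∩ (U ∩ ∁ W) ∣ ≢ ∣ X ∩ (W ∩ ∁ U) ∣
  separates = proj₂ (proj₂ separator)

-- Lemma 2.1.
lemma2p1 : (n k : ℕ) → 1 ≤ k → 2 * k ≤ n → (S : VertexSet n k) →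
    IsResolving S ⇔ DisjointCondition S
lemma2p1 n k _ 2k≤n 𝒮 =
  mk⇔ (resolving⇒disjoint-condition n k 2k≤n 𝒮) (disjoint-condition⇒resolving n k 𝒮)
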